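{- Let $n\geq 5$ be odd. The circulant graph $\mathrm{circ}(n;\pm1,\pm2)$ is not $3$-spanning cyclable.
   Context: $\mathrm{circ}(n;\pm1,\pm s)$ is the Cayley graph on $\mathbb{Z}/n\mathbb{Z}$ with connection set $\{\pm1,\pm s\}$: vertices $u_0,\dots,u_{n-1}$ (indices mod $n$), with $u_i$ adjacent to $u_{i\pm1}$ and $u_{i\pm s}$. A 2-factor of a graph is a spanning subgraph in which every vertex has valency 2; it separates a set $A$ of $k$ vertices if it consists of exactly $k$ cycles and $A$ meets the vertex set of each cycle in exactly one vertex. A graph $X$ is $k$-spanning cyclable if for every $A\subseteq V(X)$ with $|A|=k$ there is a 2-factor of $X$ separating $A$. -}

module Defs where

open import Data.Nat using (ℕ; _+_; _*_)
open import Data.Fin using (Fin; toℕ)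
open import Data.Fin.Subset using (Subset; _∈_; ∣_∣)
open import Data.Bool using (Bool; true; false; T; if_then_else_)
open import Data.List using (List; map; allFin)
open import Data.Nat.ListAction using (sum)
open import Data.Product using (Σ; ∃; _×_; _,_)
open import Data.Sum using (_⊎_)
open import Relation.Binary.PropositionalEquality using (_≡_)
open import Relation.Binary.Construct.Closure.ReflexiveTransitive using (Star)

Step : (n d : ℕ) → Fin n → Fin n → Set
Step n d i j = ∃ λ q → toℕ i + d ≡ toℕ j + q * n

CircAdj : (n s : ℕ) → Fin n → Fin n → Set
CircAdj n s i j = Step n 1 i j ⊎ Step n 1 j i ⊎ Step n s i j ⊎ Step n s j i

degree : {n : ℕ} → (Fin n → Fin n → Bool) → Fin n → ℕ
degree {n} F i = sum (map (λ j → if F i j then 1 else 0) (allFin n))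

record TwoFactor {n : ℕ} (Adj : Fin n → Fin n → Set) : Set where
  field
    F       : Fin n → Fin n → Bool
    F-sym   : ∀ i j → F i j ≡ F j i
    F-edges : ∀ i j → T (F i j) → Adj i j
    F-deg2  : ∀ i → degree F i ≡ 2

open TwoFactor public

SameCycle : {n : ℕ} {Adj : Fin n → Fin n → Set} → TwoFactor Adj → Fin n → Fin n → Set
SameCycle T2 = Star (λ u v → T (F T2 u v))

-- the 2-factor separates A: each cycle (component) meets A in exactly one vertex
-- (hence the number of cycles equals |A|)
Separates : {n : ℕ} {Adj : Fin n → Fin n → Set} → TwoFactor Adj → Subset n → Set
Separates T2 A =
  (∀ v → ∃ λ a → a ∈ A × SameCycle T2 v a) ×
  (∀ a b → a ∈ A → b ∈ A → SameCycle T2 a b → a ≡ b)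

SpanningCyclable : {n : ℕ} → (Fin n → Fin n → Set) → ℕ → Set
SpanningCyclable {n} Adj k =
  (A : Subset n) → ∣ A ∣ ≡ k → Σ (TwoFactor Adj) (λ T2 → Separates T2 A)

{-# OPTIONS --safe #-}
-- Take A = {u₂, u₃, u₄}. In a 2-factor separating A no two vertices of A are
-- joined or share a neighbour. The neighbours of u₂ are u₀, u₁, u₃, u₄, so u₂
-- must use both u₀ and u₁; the neighbours of u₃ are u₁, u₂, u₄, u₅, so u₃ must
-- use u₁ and u₅. Then u₂ and u₃ lie on a common cycle through u₁.
module Submission where

open import Defs
open import Data.Nat using (ℕ; zero; suc; _+_; _*_; _≤_; _≥_; _%_; z≤n; s≤s)
open import Data.Nat.Properties using (+-cancelʳ-≡; +-commutativeSemigroup; ≤-reflexive; 1+n≰n)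
open import Data.Nat.DivMod using ([m+kn]%n≡m%n; m<n⇒m%n≡m)
open import Algebra.Properties.CommutativeSemigroup +-commutativeSemigroup using (xy∙z≈xz∙y)
open import Data.Fin using (Fin; toℕ; #_) renaming (zero to fzero; suc to fsuc)
open import Data.Fin.Properties using (toℕ-injective; toℕ<n; nonZeroIndex) renaming (suc-injective to fsuc-injective)
open import Data.Fin.Subset using (Subset; _∈_; inside; outside) renaming (⊥ to ∅)
open import Data.Fin.Subset.Properties using (∣⊥∣≡0)
open import Data.Vec.Base using (_∷_; here; there)
open import Data.Bool using (Bool; true; false; T; if_then_else_)
open import Data.Unit using (tt)
open import Data.Empty using (⊥; ⊥-elim)
open import Data.List using (map; tabulate)
open import Data.List.Properties using (map-tabulate)
open import Data.Nat.ListAction using (sum)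
open import Data.Product using (_,_; proj₂)
open import Data.Sum using (_⊎_; inj₁; inj₂)
open import Function using (id; _∘_)
open import Relation.Binary.PropositionalEquality
open import Relation.Binary.Construct.Closure.ReflexiveTransitive using (ε; _◅_)
open import Relation.Nullary using (¬_)

private
  variable
    n d : ℕ

remainder-unique : ∀ q r {i j : Fin n} → toℕ i + q * n ≡ toℕ j + r * n → i ≡ j
remainder-unique {n} q r {i} {j} e = toℕ-injective (begin
  toℕ i                ≡⟨ m<n⇒m%n≡m (toℕ<n i) ⟨
  toℕ i % n            ≡⟨ [m+kn]%n≡m%n (toℕ i) q n ⟨
  (toℕ i + q * n) % n  ≡⟨ cong (_% n) e ⟩
  (toℕ j + r * n) % n  ≡⟨ [m+kn]%n≡m%n (toℕ j) r n ⟩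
  toℕ j % n            ≡⟨ m<n⇒m%n≡m (toℕ<n j) ⟩
  toℕ j                ∎)
  where
  open ≡-Reasoning
  instance _ = nonZeroIndex i

Step-functional : ∀ {i j j′ : Fin n} → Step n d i j → Step n d i j′ → j ≡ j′
Step-functional (q , e) (q′ , e′) = remainder-unique q q′ (trans (sym e) e′)

Step-injective : ∀ {i i′ j : Fin n} → Step n d i j → Step n d i′ j → i ≡ i′
Step-injective {n} {d} {i} {i′} {j} (q , e) (q′ , e′) =
  remainder-unique q′ q (+-cancelʳ-≡ d _ _ (begin
    toℕ i + q′ * n + d      ≡⟨ xy∙z≈xz∙y (toℕ i) (q′ * n) d ⟩
    toℕ i + d + q′ * n      ≡⟨ cong (_+ q′ * n) e ⟩
    toℕ j + q * n + q′ * n  ≡⟨ xy∙z≈xz∙y (toℕ j) (q * n) (q′ * n) ⟩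
    toℕ j + q′ * n + q * n  ≡⟨ cong (_+ q * n) e′ ⟨
    toℕ i′ + d + q * n      ≡⟨ xy∙z≈xz∙y (toℕ i′) d (q * n) ⟩
    toℕ i′ + q * n + d      ∎))
  where open ≡-Reasoning

sum-indicator-none : (g : Fin n → Bool) → (∀ j → ¬ T (g j)) →
                     sum (tabulate (λ j → if g j then 1 else 0)) ≡ 0
sum-indicator-none {zero}  g none = refl
sum-indicator-none {suc n} g none with g fzero in eq
... | true  = ⊥-elim (none fzero (subst T (sym eq) tt))
... | false = sum-indicator-none (λ j → g (fsuc j)) (λ j → none (fsuc j))

sum-indicator-subsingleton : (g : Fin n → Bool) → (∀ j k → T (g j) → T (g k) → j ≡ k) →
                             sum (tabulate (λ j → if g j then 1 else 0)) ≤ 1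
sum-indicator-subsingleton {zero}  g unique = z≤n
sum-indicator-subsingleton {suc n} g unique with g fzero in eq
... | true  = ≤-reflexive (cong suc (sum-indicator-none (λ j → g (fsuc j)) zero-only))
  where
  zero-only : ∀ j → ¬ T (g (fsuc j))
  zero-only j t with unique fzero (fsuc j) (subst T (sym eq) tt) t
  ... | ()
... | false = sum-indicator-subsingleton (λ j → g (fsuc j))
                (λ j k s t → fsuc-injective (unique (fsuc j) (fsuc k) s t))

degree-≤1 : (F : Fin n → Fin n → Bool) (i : Fin n) → (∀ j k → T (F i j) → T (F i k) → j ≡ k) →
            degree F i ≤ 1
degree-≤1 F i unique =
  subst (_≤ 1) (sym (cong sum (map-tabulate id (λ j → if F i j then 1 else 0))))
    (sum-indicator-subsingleton (F i) unique)

valency-two-forces-edge : {Adj : Fin n → Fin n → Set} (T2 : TwoFactor Adj) {i b : Fin n}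
                          (P : Fin n → Set) → (∀ {j k} → P j → P k → j ≡ k) →
                          (∀ j → T (F T2 i j) → j ≡ b ⊎ P j) → T (F T2 i b)
valency-two-forces-edge T2 {i} {b} P P-unique neighbours with F T2 i b in eq
... | true  = tt
... | false = 1+n≰n (subst (_≤ 1) (F-deg2 T2 i)
                      (degree-≤1 (F T2) i (λ j k s t → P-unique (in-P j s) (in-P k t))))
  where
  in-P : ∀ j → T (F T2 i j) → P j
  in-P j t with neighbours j t
  ... | inj₁ refl = ⊥-elim (subst T eq t)
  ... | inj₂ p    = p

module _ {A : Subset n} (T2 : TwoFactor (CircAdj n 2)) (separates : Separates T2 A) where

  edge-leaves-A : ∀ {a b j} → a ∈ A → b ∈ A → a ≢ b → T (F T2 a j) → j ≢ b
  edge-leaves-A a∈A b∈A a≢b t refl = a≢b (proj₂ separates _ _ a∈A b∈A (t ◅ ε))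

  consecutive-triple-not-separated :
    ∀ {p₂ p₁ a₀ a₁ a₂} →
    Step n 1 p₁ a₀ → Step n 1 a₀ a₁ → Step n 1 a₁ a₂ →
    Step n 2 p₂ a₀ → Step n 2 p₁ a₁ → Step n 2 a₀ a₂ →
    a₀ ∈ A → a₁ ∈ A → a₂ ∈ A → a₀ ≢ a₁ → a₁ ≢ a₂ → a₀ ≢ a₂ → ⊥
  consecutive-triple-not-separated {p₂} {p₁} {a₀} {a₁}
    p₁a₀ a₀a₁ a₁a₂ p₂a₀ p₁a₁ a₀a₂ a₀∈A a₁∈A a₂∈A a₀≢a₁ a₁≢a₂ a₀≢a₂ =
    a₀≢a₁ (proj₂ separates _ _ a₀∈A a₁∈A (a₀-p₁ ◅ subst T (F-sym T2 a₁ p₁) a₁-p₁ ◅ ε))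
    where
    a₀-p₁ : T (F T2 a₀ p₁)
    a₀-p₁ = valency-two-forces-edge T2 (_≡ p₂) (λ e e′ → trans e (sym e′)) neighbours
      where
      neighbours : ∀ j → T (F T2 a₀ j) → j ≡ p₁ ⊎ j ≡ p₂
      neighbours j t with F-edges T2 a₀ j t
      ... | inj₁ s               =
          ⊥-elim (edge-leaves-A a₀∈A a₁∈A a₀≢a₁ t (Step-functional {d = 1} {i = a₀} s a₀a₁))
      ... | inj₂ (inj₁ s)        = inj₁ (Step-injective {d = 1} {j = a₀} s p₁a₀)
      ... | inj₂ (inj₂ (inj₁ s)) =
          ⊥-elim (edge-leaves-A a₀∈A a₂∈A a₀≢a₂ t (Step-functional {d = 2} {i = a₀} s a₀a₂))
      ... | inj₂ (inj₂ (inj₂ s)) = inj₂ (Step-injective {d = 2} {j = a₀} s p₂a₀)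
    a₁-p₁ : T (F T2 a₁ p₁)
    a₁-p₁ = valency-two-forces-edge T2 (Step n 2 a₁) (Step-functional {d = 2} {i = a₁}) neighbours
      where
      neighbours : ∀ j → T (F T2 a₁ j) → j ≡ p₁ ⊎ Step n 2 a₁ j
      neighbours j t with F-edges T2 a₁ j t
      ... | inj₁ s               =
          ⊥-elim (edge-leaves-A a₁∈A a₂∈A a₁≢a₂ t (Step-functional {d = 1} {i = a₁} s a₁a₂))
      ... | inj₂ (inj₁ s)        =
          ⊥-elim (edge-leaves-A a₁∈A a₀∈A (a₀≢a₁ ∘ sym) t (Step-injective {d = 1} {j = a₁} s a₀a₁))
      ... | inj₂ (inj₂ (inj₁ s)) = inj₂ s
      ... | inj₂ (inj₂ (inj₂ s)) = inj₁ (Step-injective {d = 2} {j = a₁} s p₁a₁)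

theorem5p2 : (n : ℕ) → n ≥ 5 → n % 2 ≡ 1 → ¬ SpanningCyclable (CircAdj n 2) 3
theorem5p2 _ (s≤s (s≤s (s≤s (s≤s (s≤s (z≤n {m})))))) _ cyclable =
  let (T2 , separates) = cyclable A (cong (3 +_) (∣⊥∣≡0 m))
  in  consecutive-triple-not-separated T2 separates {# 0} {# 1} {# 2} {# 3} {# 4}
        (0 , refl) (0 , refl) (0 , refl) (0 , refl) (0 , refl) (0 , refl)
        (there (there here)) (there (there (there here))) (there (there (there (there here))))
        (λ ()) (λ ()) (λ ())
  where
  A : Subset (5 + m)
  A = outside ∷ outside ∷ inside ∷ inside ∷ inside ∷ ∅
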